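{- Let $1\le j\le s$ and $B>j$ be natural numbers and let $d=4s\sum_{1\le i\le j+1}B^i$. For all sufficiently large natural numbers $q$ there exists $\bar x\in\mathbb N^s$ such that for all $\bar a\in\{0,\dots,B-1\}^s$ and all $c\in\{0,\dots,B-1\}$: (a) if $\bar a\ne\bar0$ then $\frac qd<\bar a^{\top}\bar x-c$; (b) $\bar a^{\top}\bar x-c<qd$; and (c) $\bar a^{\top}\bar x-c=q$ if and only if $\bar a=(1,\dots,1,0,\dots,0)$ (with exactly the first $j$ entries equal to $1$) and $c=0$.
   Context: For $s$-dimensional vectors, $\bar a^{\top}\bar x=\sum_{i=1}^sa_ix_i$. -}

module Defs where

open import Data.Nat using (ℕ; zero; suc; _+_; _*_; _^_)
open import Data.Fin using (Fin; toℕ)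
open import Data.Vec.Functional using (Vector)
open import Data.Integer as ℤ using (ℤ; +_)
open import Data.Nat.Base using (_<ᵇ_)
open import Relation.Binary.PropositionalEquality using (_≡_)
open import Data.Bool using (if_then_else_)

dot : ∀ {s} → Vector ℕ s → Vector ℕ s → ℕ
dot {zero}  a x = 0
dot {suc s} a x = a Fin.zero * x Fin.zero + dot (λ i → a (Fin.suc i)) (λ i → x (Fin.suc i))

sumPow : ℕ → ℕ → ℕ
sumPow B zero    = 0
sumPow B (suc n) = sumPow B n + B ^ suc n

dConst : ℕ → ℕ → ℕ → ℕ
dConst s j B = 4 * s * sumPow B (suc j)

_≗ᵥ_ : ∀ {s} → Vector ℕ s → Vector ℕ s → Set
a ≗ᵥ b = ∀ i → a i ≡ b i

firstOnes : ∀ {s} → ℕ → Vector ℕ s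
firstOnes j i = if toℕ i <ᵇ j then 1 else 0

-- Write B = b + 1, j = j₀ + 1 and q = P u + r with P = B ^ j₀ and r < P.  With the weights
-- w₀ = u and wₖ = b (w₀ + ⋯ + wₖ₋₁), so that w₀ + ⋯ + wₖ₋₁ = Bᵏ⁻¹ u, take
-- x = (r + w_{j-1}, …, w₁, w₀, G, …, G) with G = q + B; its first j entries sum to q.
-- The weights behave like the places of a base-B expansion: coefficients at most b on
-- w₀, …, wₖ₋₁ give at most b (w₀ + ⋯ + wₖ₋₁) < w₀ + ⋯ + wₖ, while wₖ exceeds w₀ + ⋯ + wₖ₋₁
-- by at least B as long as k < b.  Hence in a ⬝ x = q + c the coefficient of the largest
-- weight must be 1, and peeling it off recurses down to the entries G, whose coefficients
-- must vanish since G > q + c.  The bounds (a) and (b) hold because every entry of x lies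
-- between u ≈ q / Bʲ⁻¹ and G ≤ 2q.
module Submission where

open import Defs
open import Data.Nat
  using (ℕ; zero; suc; _+_; _*_; _^_; _∸_; _≤_; _<_; z≤n; s≤s; NonZero; >-nonZero; _/_; _%_)
open import Data.Nat.Properties
open import Data.Nat.DivMod using (m≡m%n+[m/n]*n; m%n<n; m*n/n≡m; m/n≤m; /-monoˡ-≤)
open import Data.Nat.Tactic.RingSolver using (solve-∀)
open import Data.Fin using (Fin)
open import Data.Fin.Properties using (all?)
open import Data.Vec.Functional using (Vector; head; tail)
open import Data.Integer as ℤ using (+_)
import Data.Integer.Properties as ℤ
import Data.Integer.Tactic.RingSolver as ℤ-Solver
open import Data.Product using (_×_; ∃; _,_)
open import Data.Product.Algebra using (×-assoc)
open import Data.Product.Function.NonDependent.Propositional using (_×-⇔_)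
open import Data.Sum using (_⊎_; inj₁; inj₂; [_,_]′)
open import Data.Empty using (⊥-elim)
open import Function using (_∘_)
open import Function.Bundles using (_⇔_; mk⇔; Equivalence)
import Function.Properties.Equivalence as ⇔
open import Function.Related.Propositional using (module EquationalReasoning)
open import Relation.Binary.PropositionalEquality
open import Relation.Nullary using (¬_; yes; no)

≗ᵥ-head-tail : ∀ {n} {a b : Vector ℕ (suc n)} →
               (a ≗ᵥ b) ⇔ (head a ≡ head b × tail a ≗ᵥ tail b)
≗ᵥ-head-tail = mk⇔ (λ a≗b → a≗b Fin.zero , λ i → a≗b (Fin.suc i))
                   (λ { (a₀≡b₀ , _)     Fin.zero    → a₀≡b₀
                      ; (_     , a′≗b′) (Fin.suc i) → a′≗b′ i })

dot-zeroˡ : ∀ {n} (a x : Vector ℕ n) → a ≗ᵥ (λ _ → 0) → dot a x ≡ 0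
dot-zeroˡ {zero}  a x a≗0 = refl
dot-zeroˡ {suc n} a x a≗0 rewrite a≗0 Fin.zero = dot-zeroˡ (tail a) (tail x) (a≗0 ∘ Fin.suc)

dot-≤ : ∀ {n} (a x : Vector ℕ n) {m M} → (∀ i → a i ≤ m) → (∀ i → x i ≤ M) → dot a x ≤ n * (m * M)
dot-≤ {zero}  a x a≤m x≤M = z≤n
dot-≤ {suc n} a x a≤m x≤M =
  +-mono-≤ (*-mono-≤ (a≤m Fin.zero) (x≤M Fin.zero))
           (dot-≤ (tail a) (tail x) (λ i → a≤m (Fin.suc i)) (λ i → x≤M (Fin.suc i)))

dot-≥ : ∀ {n} (a x : Vector ℕ n) {M} → (∀ i → M ≤ x i) → ¬ (a ≗ᵥ (λ _ → 0)) → M ≤ dot a x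
dot-≥ {zero}  a x M≤x a≢0 = ⊥-elim (a≢0 λ ())
dot-≥ {suc n} a x M≤x a≢0 with a Fin.zero in a₀≡
... | suc a₀ = ≤-trans (M≤x Fin.zero) (≤-trans (m≤m+n (x Fin.zero) _) (m≤m+n _ _))
... | zero   = dot-≥ (tail a) (tail x) (λ i → M≤x (Fin.suc i))
                     (λ a′≗0 → a≢0 (Equivalence.from ≗ᵥ-head-tail (a₀≡ , a′≗0)))

dot-zero⊎≥ : ∀ {n} (a x : Vector ℕ n) {M} → (∀ i → M ≤ x i) → a ≗ᵥ (λ _ → 0) ⊎ M ≤ dot a x
dot-zero⊎≥ a x M≤x with all? (λ i → a i ≟ 0)
... | yes a≗0 = inj₁ a≗0
... | no  a≢0 = inj₂ (dot-≥ a x M≤x a≢0)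

dot≡small⇔zero : ∀ {n} (a x : Vector ℕ n) {M c} → (∀ i → M ≤ x i) → c < M →
                 (dot a x ≡ c) ⇔ (a ≗ᵥ (λ _ → 0) × c ≡ 0)
dot≡small⇔zero a x {c = c} M≤x c<M = mk⇔ to from
  where
  to : dot a x ≡ c → a ≗ᵥ (λ _ → 0) × c ≡ 0
  to ax≡c with dot-zero⊎≥ a x M≤x
  ... | inj₁ a≗0 = a≗0 , trans (sym ax≡c) (dot-zeroˡ a x a≗0)
  ... | inj₂ M≤ax = ⊥-elim (<⇒≢ (<-≤-trans c<M M≤ax) (sym ax≡c))
  from : a ≗ᵥ (λ _ → 0) × c ≡ 0 → dot a x ≡ c
  from (a≗0 , refl) = dot-zeroˡ a x a≗0

-- h is the largest weight, D the contribution of the smaller ones and l their total.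
digit-step : ∀ {b B G h l c D} a₀ → c < B → l + B ≤ h → b * l < h + l → h + (l + B) ≤ G →
             D ≤ b * l ⊎ G ≤ D → (a₀ * h + D ≡ h + (l + c)) ⇔ (a₀ ≡ 1 × D ≡ l + c)
digit-step {b} {B} {G} {h} {l} {c} {D} a₀ c<B l+B≤h bl<h+l h+l+B≤G D-gap = mk⇔ (to a₀) from
  where
  target<h+l+B : h + (l + c) < h + (l + B)
  target<h+l+B = +-monoʳ-< h (+-monoʳ-< l c<B)
  bl<target : b * l < h + (l + c)
  bl<target = <-≤-trans bl<h+l (+-monoʳ-≤ h (m≤m+n l c))
  to : ∀ a₀ → a₀ * h + D ≡ h + (l + c) → a₀ ≡ 1 × D ≡ l + c
  to zero D≡target =
    ⊥-elim ([ (λ D≤bl → <⇒≢ (≤-<-trans D≤bl bl<target) D≡target)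
            , (λ G≤D → >⇒≢ (<-≤-trans target<h+l+B (≤-trans h+l+B≤G G≤D)) D≡target)
            ]′ D-gap)
  to (suc zero) h+D≡target =
    refl , +-cancelˡ-≡ h D (l + c) (trans (cong (_+ D) (sym (*-identityˡ h))) h+D≡target)
  to (suc (suc a₀)) ah+D≡target = ⊥-elim (<⇒≢ overshoot (sym ah+D≡target))
    where
    overshoot : h + (l + c) < suc (suc a₀) * h + D
    overshoot = <-≤-trans target<h+l+B
      (≤-trans (+-monoʳ-≤ h (≤-trans l+B≤h (m≤m+n h (a₀ * h)))) (m≤m+n _ D))
  from : a₀ ≡ 1 × D ≡ l + c → a₀ * h + D ≡ h + (l + c)
  from (refl , refl) = cong (_+ (l + c)) (*-identityˡ h)

module Weights (b u G : ℕ) .{{_ : NonZero b}} (B≤u : suc b ≤ u) where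

  B : ℕ
  B = suc b

  weight weightSum : ℕ → ℕ
  weight zero    = u
  weight (suc k) = b * weightSum (suc k)
  weightSum zero    = 0
  weightSum (suc k) = weight k + weightSum k

  weightSum-closed : ∀ k → weightSum (suc k) ≡ B ^ k * u
  weightSum-closed zero    = refl
  weightSum-closed (suc k) rewrite weightSum-closed k = distrib b (B ^ k) u
    where
    distrib : ∀ b p u → b * (p * u) + p * u ≡ suc b * p * u
    distrib = solve-∀

  0<u : 0 < u
  0<u = ≤-trans (s≤s z≤n) B≤u

  u≤weight : ∀ k → u ≤ weight k
  u≤weightSum : ∀ k → u ≤ weightSum (suc k)
  u≤weight zero    = ≤-refl
  u≤weight (suc k) = ≤-trans (u≤weightSum k) (m≤n*m _ b)
  u≤weightSum k = ≤-trans (u≤weight k) (m≤m+n _ _)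

  b*weightSum<weightSum : ∀ k → b * weightSum k < weightSum (suc k)
  b*weightSum<weightSum zero    =
    ≤-<-trans (≤-reflexive (*-zeroʳ b)) (<-≤-trans 0<u (u≤weightSum 0))
  b*weightSum<weightSum (suc k) = m<m+n _ (<-≤-trans 0<u (u≤weightSum k))

  weightSum+B≤weight : ∀ k → suc k ≤ b → weightSum k + B ≤ weight k
  weightSum+B≤weight zero    _   = B≤u
  weightSum+B≤weight (suc k) k<b = begin
    S + B     ≤⟨ +-monoʳ-≤ S (≤-trans B≤u (u≤weightSum k)) ⟩
    S + S     ≡⟨ cong (_+_ S) (sym (+-identityʳ S)) ⟩
    2 * S     ≤⟨ *-monoˡ-≤ S (≤-trans (s≤s (s≤s z≤n)) k<b) ⟩
    b * S     ∎
    where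
    open ≤-Reasoning
    S = weightSum (suc k)

  weights : ∀ {n} → ℕ → ℕ → Vector ℕ n
  weights zero    r i           = G
  weights (suc k) r Fin.zero    = r + weight k
  weights (suc k) r (Fin.suc i) = weights k 0 i

  u≤weights : u ≤ G → ∀ {n} k r (i : Fin n) → u ≤ weights k r i
  u≤weights u≤G zero    r i           = u≤G
  u≤weights u≤G (suc k) r Fin.zero    = ≤-trans (u≤weight k) (m≤n+m _ r)
  u≤weights u≤G (suc k) r (Fin.suc i) = u≤weights u≤G k 0 i

  weights≤G : ∀ {n} k r → r + weightSum k ≤ G → (i : Fin n) → weights k r i ≤ G
  weights≤G zero    r _   i           = ≤-refl
  weights≤G (suc k) r r+S≤G Fin.zero    =
    ≤-trans (+-monoʳ-≤ r (m≤m+n (weight k) (weightSum k))) r+S≤G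
  weights≤G (suc k) r r+S≤G (Fin.suc i) =
    weights≤G k 0 (≤-trans (≤-trans (m≤n+m _ (weight k)) (m≤n+m _ r)) r+S≤G) i

  dot-weights-gap : ∀ {n} k (a : Vector ℕ n) → (∀ i → a i ≤ b) →
                    dot a (weights k 0) ≤ b * weightSum k ⊎ G ≤ dot a (weights k 0)
  dot-weights-gap zero a a≤b with dot-zero⊎≥ a (weights zero 0) (λ _ → ≤-refl)
  ... | inj₁ a≗0 = inj₁ (≤-trans (≤-reflexive (dot-zeroˡ a _ a≗0)) z≤n)
  ... | inj₂ G≤D = inj₂ G≤D
  dot-weights-gap {zero}  (suc k) a a≤b = inj₁ z≤n
  dot-weights-gap {suc n} (suc k) a a≤b with dot-weights-gap k (tail a) (λ i → a≤b (Fin.suc i))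
  ... | inj₂ G≤D = inj₂ (≤-trans G≤D (m≤n+m _ _))
  ... | inj₁ D≤bl = inj₁ (≤-trans (+-mono-≤ (*-monoˡ-≤ (weight k) (a≤b Fin.zero)) D≤bl)
                                  (≤-reflexive (sym (*-distribˡ-+ b (weight k) (weightSum k)))))

  weights₀-exact : ∀ {n} k (a : Vector ℕ n) c → k ≤ n → k ≤ b → weightSum k + B ≤ G →
                   (∀ i → a i ≤ b) → c < B →
                   (dot a (weights k 0) ≡ weightSum k + c) ⇔ (a ≗ᵥ firstOnes k × c ≡ 0)
  weights-exact : ∀ {n} k r (a : Vector ℕ n) c → suc k ≤ n → suc k ≤ b →
                  r + weightSum (suc k) + B ≤ G → (∀ i → a i ≤ b) → c < B →
                  (dot a (weights (suc k) r) ≡ r + weightSum (suc k) + c) ⇔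
                  (a ≗ᵥ firstOnes (suc k) × c ≡ 0)

  weights₀-exact zero    a c _ _ B≤G _ c<B =
    dot≡small⇔zero a (weights zero 0) (λ _ → ≤-refl) (<-≤-trans c<B B≤G)
  weights₀-exact (suc k) = weights-exact k 0

  weights-exact {suc n} k r a c (s≤s k≤n) k<b ≤G a≤b c<B = begin
    (dot a (weights (suc k) r) ≡ r + weightSum (suc k) + c)
      ≡⟨ cong (dot a (weights (suc k) r) ≡_) (regroup c) ⟩
    (head a * h + D ≡ h + (l + c))
      ∼⟨ digit-step {b = b} (head a) c<B l+B≤h bl<h+l h+[l+B]≤G
                    (dot-weights-gap k (tail a) (λ i → a≤b (Fin.suc i))) ⟩
    (head a ≡ 1 × D ≡ l + c)
      ∼⟨ ⇔.refl ×-⇔ weights₀-exact k (tail a) c k≤n (≤-trans (n≤1+n k) k<b) l+B≤G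
                                         (λ i → a≤b (Fin.suc i)) c<B ⟩
    (head a ≡ 1 × (tail a ≗ᵥ firstOnes k × c ≡ 0))
      ↔⟨ ×-assoc _ _ _ _ ⟨
    ((head a ≡ 1 × tail a ≗ᵥ firstOnes k) × c ≡ 0)
      ∼⟨ ⇔.sym ≗ᵥ-head-tail ×-⇔ ⇔.refl ⟩
    (a ≗ᵥ firstOnes (suc k) × c ≡ 0) ∎
    where
    open EquationalReasoning
    h = r + weight k
    l = weightSum k
    D = dot (tail a) (weights k 0)
    regroup : ∀ m → r + (weight k + l) + m ≡ h + (l + m)
    regroup m = trans (cong (_+ m) (sym (+-assoc r (weight k) l))) (+-assoc h l m)
    h+[l+B]≤G : h + (l + B) ≤ G
    h+[l+B]≤G = ≤-trans (≤-reflexive (sym (regroup B))) ≤G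
    l+B≤h : l + B ≤ h
    l+B≤h = ≤-trans (weightSum+B≤weight k k<b) (m≤n+m _ r)
    bl<h+l : b * l < h + l
    bl<h+l = <-≤-trans (b*weightSum<weightSum k) (+-monoˡ-≤ l (m≤n+m _ r))
    l+B≤G : l + B ≤ G
    l+B≤G = ≤-trans (+-monoˡ-≤ B (≤-trans (m≤n+m l (weight k)) (m≤n+m _ r))) ≤G

+m-+n≡+o⇔m≡o+n : ∀ m n o → ((+ m) ℤ.- (+ n) ≡ + o) ⇔ (m ≡ o + n)
+m-+n≡+o⇔m≡o+n m n o = mk⇔ to from
  where
  add-back : ∀ i j → i ≡ (i ℤ.- j) ℤ.+ j
  add-back = ℤ-Solver.solve-∀
  cancel : ∀ i j → (i ℤ.+ j) ℤ.- j ≡ i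
  cancel = ℤ-Solver.solve-∀
  to : (+ m) ℤ.- (+ n) ≡ + o → m ≡ o + n
  to m-n≡o = ℤ.+-injective (trans (add-back (+ m) (+ n)) (cong (ℤ._+ (+ n)) m-n≡o))
  from : m ≡ o + n → (+ m) ℤ.- (+ n) ≡ + o
  from refl = cancel (+ o) (+ n)

+o<+p*[+m-+n] : ∀ {m n o} p → n ≤ m → o < p * (m ∸ n) → (+ o) ℤ.< (+ p) ℤ.* ((+ m) ℤ.- (+ n))
+o<+p*[+m-+n] {m} {n} {o} p n≤m o<p*[m∸n] = subst ((+ o) ℤ.<_) +p*[m∸n]≡ (ℤ.+<+ o<p*[m∸n])
  where
  +p*[m∸n]≡ : + (p * (m ∸ n)) ≡ (+ p) ℤ.* ((+ m) ℤ.- (+ n))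
  +p*[m∸n]≡ = trans (ℤ.pos-* p (m ∸ n))
                    (cong ((+ p) ℤ.*_) (sym (trans (ℤ.[+m]-[+n]≡m⊖n m n) (ℤ.⊖-≥ n≤m))))

+m-+n<+o*+p : ∀ {m} n o p → m < o * p → (+ m) ℤ.- (+ n) ℤ.< (+ o) ℤ.* (+ p)
+m-+n<+o*+p {m} n o p m<o*p =
  ℤ.≤-<-trans (ℤ.i-j≤i (+ m) (+ n)) (subst ((+ m) ℤ.<_) (ℤ.pos-* o p) (ℤ.+<+ m<o*p))

t+B≤B*[B*t] : ∀ b t .{{_ : NonZero b}} .{{_ : NonZero t}} → t + suc b ≤ suc b * (suc b * t)
t+B≤B*[B*t] b t = +-mono-≤ (m≤n*m t (suc b)) (≤-trans (m≤m*n (suc b) t) (m≤n*m (suc b * t) b))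

module Witness (s′ j₀ b q : ℕ) (j≤s : suc j₀ ≤ suc s′) (j≤b : suc j₀ ≤ b)
               (Bʲ≤q : suc b ^ suc j₀ ≤ q) where

  B P u r G : ℕ
  B = suc b
  P = B ^ j₀
  instance
    P≢0 : NonZero P
    P≢0 = m^n≢0 B j₀
    b≢0 : NonZero b
    b≢0 = >-nonZero (≤-trans (s≤s z≤n) j≤b)
  u = q / P
  r = q % P
  G = q + B

  B≤u : B ≤ u
  B≤u = ≤-trans (≤-reflexive (sym (m*n/n≡m B P))) (/-monoˡ-≤ P Bʲ≤q)

  open Weights b u G B≤u hiding (B)

  x : Vector ℕ (suc s′)
  x = weights (suc j₀) r

  q≡r+weightSum : q ≡ r + weightSum (suc j₀)
  q≡r+weightSum = trans (m≡m%n+[m/n]*n q P)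
                        (cong (_+_ r) (trans (*-comm u P) (sym (weightSum-closed j₀))))

  r+weightSum+B≤G : r + weightSum (suc j₀) + B ≤ G
  r+weightSum+B≤G = ≤-reflexive (cong (_+ B) (sym q≡r+weightSum))

  B≤q : B ≤ q
  B≤q = ≤-trans (m≤m*n B P) Bʲ≤q

  u≤x : ∀ i → u ≤ x i
  u≤x = u≤weights (≤-trans (m/n≤m q P) (m≤m+n q B)) (suc j₀) r

  S d : ℕ
  S = sumPow B (suc (suc j₀))
  d = dConst (suc s′) (suc j₀) B

  Bʲ⁺¹≤S : B * (B * P) ≤ S
  Bʲ⁺¹≤S = m≤n+m (B * (B * P)) (sumPow B (suc j₀))

  q<d*[u∸b] : q < d * (u ∸ b)
  q<d*[u∸b] = begin-strict
    q                     ≡⟨ m≡m%n+[m/n]*n q P ⟩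
    r + u * P             <⟨ +-monoˡ-< (u * P) (m%n<n q P) ⟩
    suc u * P             ≡⟨ cong (_* P) suc-u≡t+B ⟩
    (t + B) * P           ≤⟨ *-monoˡ-≤ P (t+B≤B*[B*t] b t) ⟩
    B * (B * t) * P       ≡⟨ swap-t-P B t P ⟩
    B * (B * P) * t       ≤⟨ *-monoˡ-≤ t Bʲ⁺¹≤S ⟩
    S * t                 ≤⟨ *-monoˡ-≤ t (m≤n*m S (4 * suc s′)) ⟩
    d * t                 ∎
    where
    open ≤-Reasoning
    t = u ∸ b
    instance
      t≢0 : NonZero t
      t≢0 = >-nonZero (≤-trans (≤-reflexive (sym (m+n∸n≡m 1 b))) (∸-monoˡ-≤ b B≤u))
    suc-u≡t+B : suc u ≡ t + B
    suc-u≡t+B = trans (cong suc (sym (m∸n+n≡m (≤-trans (n≤1+n b) B≤u)))) (sym (+-suc t b))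
    swap-t-P : ∀ B t P → B * (B * t) * P ≡ B * (B * P) * t
    swap-t-P = solve-∀

  dot<q*d : ∀ a → (∀ i → a i ≤ b) → dot a x < q * d
  dot<q*d a a≤b = begin-strict
    dot a x                      ≤⟨ dot-≤ a x a≤b x≤G ⟩
    suc s′ * (b * (q + B))       ≤⟨ *-monoʳ-≤ (suc s′) (*-monoʳ-≤ b (+-monoʳ-≤ q B≤q)) ⟩
    suc s′ * (b * (q + q))       <⟨ *-monoʳ-< (suc s′) (m<n+m (b * (q + q)) 0<q+q) ⟩
    suc s′ * (B * (q + q))       ≤⟨ *-monoʳ-≤ (suc s′) (*-monoˡ-≤ (q + q) B≤S) ⟩
    suc s′ * (S * (q + q))       ≤⟨ m≤m+n _ _ ⟩
    suc s′ * (S * (q + q)) + suc s′ * (S * (q + q)) ≡⟨ sym (double-double q (suc s′) S) ⟩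
    q * d                        ∎
    where
    open ≤-Reasoning
    x≤G : ∀ i → x i ≤ G
    x≤G = weights≤G (suc j₀) r (≤-trans (m≤m+n _ B) r+weightSum+B≤G)
    0<q+q : 0 < q + q
    0<q+q = ≤-trans (s≤s z≤n) (≤-trans B≤q (m≤m+n q q))
    B≤S : B ≤ S
    B≤S = ≤-trans (m≤m*n B (B * P) {{m*n≢0 B P}}) Bʲ⁺¹≤S
    double-double : ∀ q s S → q * (4 * s * S) ≡ s * (S * (q + q)) + s * (S * (q + q))
    double-double = solve-∀

  module _ (a : Vector ℕ (suc s′)) (a<B : ∀ i → a i < B) (c : ℕ) (c<B : c < B) where

    a≤b : ∀ i → a i ≤ b
    a≤b i = ≤-pred (a<B i)

    lower : ¬ (a ≗ᵥ (λ _ → 0)) → (+ q) ℤ.< (+ d) ℤ.* ((+ dot a x) ℤ.- (+ c))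
    lower a≢0 =
      +o<+p*[+m-+n] d c≤ax (<-≤-trans q<d*[u∸b] (*-monoʳ-≤ d (∸-mono u≤ax (≤-pred c<B))))
      where
      u≤ax : u ≤ dot a x
      u≤ax = dot-≥ a x u≤x a≢0
      c≤ax : c ≤ dot a x
      c≤ax = ≤-trans (≤-pred c<B) (≤-trans (n≤1+n b) (≤-trans B≤u u≤ax))

    upper : (+ dot a x) ℤ.- (+ c) ℤ.< (+ q) ℤ.* (+ d)
    upper = +m-+n<+o*+p c q d (dot<q*d a a≤b)

    exact : ((+ dot a x) ℤ.- (+ c) ≡ + q) ⇔ (a ≗ᵥ firstOnes (suc j₀) × c ≡ 0)
    exact = begin
      ((+ dot a x) ℤ.- (+ c) ≡ + q)          ∼⟨ +m-+n≡+o⇔m≡o+n (dot a x) c q ⟩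
      (dot a x ≡ q + c)                      ≡⟨ cong (λ p → dot a x ≡ p + c) q≡r+weightSum ⟩
      (dot a x ≡ r + weightSum (suc j₀) + c)
        ∼⟨ weights-exact j₀ r a c j≤s j≤b r+weightSum+B≤G a≤b c<B ⟩
      (a ≗ᵥ firstOnes (suc j₀) × c ≡ 0)      ∎
      where open EquationalReasoning

lemma38 : (s j B : ℕ) → 1 ≤ j → j ≤ s → j < B →
    ∃ λ (Q : ℕ) → (q : ℕ) → Q ≤ q →
    ∃ λ (x : Vector ℕ s) →
    (a : Vector ℕ s) → (∀ i → a i < B) → (c : ℕ) → c < B →
    ((¬ (a ≗ᵥ (λ _ → 0))) →
    (+ q) ℤ.< (+ dConst s j B) ℤ.* ((+ dot a x) ℤ.- (+ c)))
    × ((+ dot a x) ℤ.- (+ c) ℤ.< (+ q) ℤ.* (+ dConst s j B))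
    × (((+ dot a x) ℤ.- (+ c) ≡ + q) ⇔ ((a ≗ᵥ firstOnes j) × c ≡ 0))
lemma38 (suc s′) (suc j₀) (suc b) (s≤s z≤n) j≤s (s≤s j≤b) = suc b ^ suc j₀ , λ q Bʲ≤q →
  let open Witness s′ j₀ b q j≤s j≤b Bʲ≤q in
  x , λ a a<B c c<B → lower a a<B c c<B , upper a a<B c c<B , exact a a<B c c<B
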